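{- For non-negative integers $n$ and $\ell$, and real number $m$, $$D_m(n+\ell;x)=\sum_{j=0}^{\ell}\sum_{k=0}^nW_m(\ell,j)\binom{n}{k}(mj)^{n-k}D_m(k;x)\,x^j$$ and $$D_m(n+\ell)=\sum_{j=0}^{\ell}\sum_{k=0}^nW_m(\ell,j)\binom{n}{k}(mj)^{n-k}D_m(k).$$
   Context: The Whitney numbers of the second kind of Dowling lattices $W_m(n,k)$ are the coefficients in $(mt+1)^n=\sum_{k=0}^nm^kW_m(n,k)(t)_k$, where $(t)_k=t(t-1)\cdots(t-k+1)$; equivalently $W_m(0,0)=1$, $W_m(n,k)=0$ for $k<0$ or $k>n$, and $W_m(n,k)=W_m(n-1,k-1)+(mk+1)W_m(n-1,k)$ for $n\ge1$. The Dowling polynomials are $D_m(n;x)=\sum_{k=0}^nW_m(n,k)x^k$ and the Dowling numbers are $D_m(n)=D_m(n;1)$. The convention $0^0=1$ is used. -}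

module Defs where

open import Level using (Level)
open import Algebra.Bundles using (CommutativeRing)
import Algebra.Bundles
open import Data.Nat using (ℕ; zero; suc; _∸_)
import Data.Nat as ℕ
open import Data.Nat.Combinatorics using (_C_)
import Algebra.Definitions.RawSemiring as RS

-- All definitions are parametrised by a commutative ring R (standing in for ℝ)
-- and the parameter m ∈ R.
module Dowling {c ℓ : Level} (R : CommutativeRing c ℓ) where
  open CommutativeRing R
  open RS (Algebra.Bundles.Semiring.rawSemiring semiring) using (_×_; _^_) public

  ι : ℕ → Carrier
  ι k = k × 1#

  Σ≤ : ℕ → (ℕ → Carrier) → Carrier
  Σ≤ zero    f = f 0
  Σ≤ (suc n) f = Σ≤ n f + f (suc n)

  W : Carrier → ℕ → ℕ → Carrier
  W m zero    zero    = 1#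
  W m zero    (suc k) = 0#
  W m (suc n) zero    = (m * ι 0 + 1#) * W m n 0
  W m (suc n) (suc k) = W m n k + (m * ι (suc k) + 1#) * W m n (suc k)

  D : Carrier → ℕ → Carrier → Carrier
  D m n x = Σ≤ n (λ k → W m n k * (x ^ k))

  Dnum : Carrier → ℕ → Carrier
  Dnum m n = D m n 1#

module Submission where

-- We work with coefficient sequences ℕ → R.  The Whitney recurrence is a linear
-- operator T on sequences, with W_m(i,·) = Tⁱ δ and W_m(n+l,·) = Tⁿ W_m(l,·).
-- Writing U_a = T + a, the operator T conjugates shifts:  T ∘ shiftʲ = shiftʲ ∘ U_{mj},
-- because the factor mk+1 at position k+j equals (mk+1) + mj.  Since T and a commute,
-- the binomial theorem gives U_aⁿ = Σ_i C(n,i) aⁿ⁻ⁱ Tⁱ.  Expanding W_m(l,·) in the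
-- basis shiftʲ δ therefore yields the coefficient identity (whitney-convolution)
--   W_m(n+l,·) = Σ_j W_m(l,j) Σ_i C(n,i) (mj)ⁿ⁻ⁱ shiftʲ W_m(i,·),
-- and evaluating at x (shiftʲ contributes a factor xʲ) gives the polynomial identity;
-- the identity for Dowling numbers is its instance x = 1.
-- The file develops, in order: finite sums; sequences, linear operators and iterates;
-- shifts and unit vectors; binomial coefficients (Pascal); evaluation at x; the Whitney
-- operator with the two identities; corollary6.

open import Defs
open import Level using (Level; _⊔_)
open import Algebra.Bundles using (CommutativeRing)
open import Data.Nat using (ℕ; zero; suc; _∸_; _≤_; _<_; z≤n; s≤s)
import Data.Nat as ℕ
import Data.Nat.Properties as ℕₚ
open import Data.Nat.Combinatorics using (_C_; nCk+nC[k+1]≡[n+1]C[k+1])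
open import Data.Nat.Combinatorics.Specification using (k>n⇒nCk≡0)
open import Data.Sum using (inj₁; inj₂)
open import Data.Empty using (⊥-elim)
open import Function using (_∘_)
open import Relation.Nullary using (¬_; yes; no)
import Relation.Binary.PropositionalEquality as ≡

module DowlingExpansion {c ℓ : Level} (R : CommutativeRing c ℓ) where
  open CommutativeRing R
  open Dowling R using (ι; _^_; Σ≤; W; D; Dnum)
  open import Algebra.Solver.Ring.NaturalCoefficients.Default commutativeSemiring
  open import Algebra.Properties.Monoid.Mult +-monoid using (×-homo-+)
  open import Relation.Binary.Reasoning.Setoid setoid

  Σ-congᵇ : ∀ N {f g : ℕ → Carrier} → (∀ i → i ≤ N → f i ≈ g i) → Σ≤ N f ≈ Σ≤ N g
  Σ-congᵇ zero    f≈g = f≈g 0 z≤n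
  Σ-congᵇ (suc N) f≈g =
    +-cong (Σ-congᵇ N (λ i i≤N → f≈g i (ℕₚ.m≤n⇒m≤1+n i≤N))) (f≈g (suc N) ℕₚ.≤-refl)

  Σ-cong : ∀ N {f g : ℕ → Carrier} → (∀ i → f i ≈ g i) → Σ≤ N f ≈ Σ≤ N g
  Σ-cong N f≈g = Σ-congᵇ N (λ i _ → f≈g i)

  Σ-zero : ∀ N {f : ℕ → Carrier} → (∀ i → i ≤ N → f i ≈ 0#) → Σ≤ N f ≈ 0#
  Σ-zero N f≈0 = trans (Σ-congᵇ N f≈0) (zero-sum N)
    where
    zero-sum : ∀ N → Σ≤ N (λ _ → 0#) ≈ 0#
    zero-sum zero    = refl
    zero-sum (suc N) = trans (+-identityʳ _) (zero-sum N)

  Σ-+ : ∀ N (f g : ℕ → Carrier) → Σ≤ N (λ i → f i + g i) ≈ Σ≤ N f + Σ≤ N g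
  Σ-+ zero    f g = refl
  Σ-+ (suc N) f g = trans (+-congʳ (Σ-+ N f g))
    (solve 4 (λ A B a b → (A :+ B) :+ (a :+ b) := (A :+ a) :+ (B :+ b)) refl _ _ _ _)

  Σ-*ˡ : ∀ N a (f : ℕ → Carrier) → Σ≤ N (λ i → a * f i) ≈ a * Σ≤ N f
  Σ-*ˡ zero    a f = refl
  Σ-*ˡ (suc N) a f = trans (+-congʳ (Σ-*ˡ N a f)) (sym (distribˡ a _ _))

  Σ-*ʳ : ∀ N a (f : ℕ → Carrier) → Σ≤ N (λ i → f i * a) ≈ Σ≤ N f * a
  Σ-*ʳ zero    a f = refl
  Σ-*ʳ (suc N) a f = trans (+-congʳ (Σ-*ʳ N a f)) (sym (distribʳ a _ _))

  Σ-head : ∀ N (f : ℕ → Carrier) → Σ≤ (suc N) f ≈ f 0 + Σ≤ N (f ∘ suc)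
  Σ-head zero    f = refl
  Σ-head (suc N) f = trans (+-congʳ (Σ-head N f)) (+-assoc _ _ _)

  Σ-swap : ∀ N M (h : ℕ → ℕ → Carrier) →
           Σ≤ N (λ k → Σ≤ M (λ j → h j k)) ≈ Σ≤ M (λ j → Σ≤ N (h j))
  Σ-swap zero    M h = refl
  Σ-swap (suc N) M h = trans (+-congʳ (Σ-swap N M h)) (sym (Σ-+ M _ _))

  -- Coefficient sequences; polynomials are the sequences of finite support.
  Seq : Set c
  Seq = ℕ → Carrier

  _≐_ : Seq → Seq → Set ℓ
  u ≐ v = ∀ k → u k ≈ v k

  combo : ℕ → (ℕ → Carrier) → (ℕ → Seq) → Seq
  combo M s vs k = Σ≤ M (λ j → s j * vs j k)

  combo-cong : ∀ M s {vs ws : ℕ → Seq} → (∀ j → vs j ≐ ws j) → combo M s vs ≐ combo M s ws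
  combo-cong M s vs≐ws k = Σ-cong M (λ j → *-congˡ (vs≐ws j k))

  -- Scaling a combination termwise, and adding a scaled combination of a second family:
  -- the two shapes in which the Whitney recurrence acts on a linear combination.
  combo-scale : ∀ M a (s : ℕ → Carrier) (g : ℕ → Carrier) →
                a * Σ≤ M (λ j → s j * g j) ≈ Σ≤ M (λ j → s j * (a * g j))
  combo-scale M a s g = trans (sym (Σ-*ˡ M a _))
    (Σ-cong M (λ j → solve 3 (λ a s g → a :* (s :* g) := s :* (a :* g)) refl a (s j) (g j)))

  combo-step : ∀ M a (s f g : ℕ → Carrier) →
               Σ≤ M (λ j → s j * f j) + a * Σ≤ M (λ j → s j * g j) ≈ Σ≤ M (λ j → s j * (f j + a * g j))
  combo-step M a s f g = begin
    Σ≤ M (λ j → s j * f j) + a * Σ≤ M (λ j → s j * g j)   ≈⟨ +-congˡ (combo-scale M a s g) ⟩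
    Σ≤ M (λ j → s j * f j) + Σ≤ M (λ j → s j * (a * g j)) ≈⟨ Σ-+ M _ _ ⟨
    Σ≤ M (λ j → s j * f j + s j * (a * g j))               ≈⟨ Σ-cong M (λ j → distribˡ _ _ _) ⟨
    Σ≤ M (λ j → s j * (f j + a * g j))                     ∎

  Congruent : (Seq → Seq) → Set (c ⊔ ℓ)
  Congruent F = ∀ {u v} → u ≐ v → F u ≐ F v

  Linear : (Seq → Seq) → Set (c ⊔ ℓ)
  Linear F = ∀ M s vs → F (combo M s vs) ≐ combo M s (F ∘ vs)

  iter : (Seq → Seq) → ℕ → Seq → Seq
  iter F zero    v = v
  iter F (suc n) v = F (iter F n v)

  iter-cong : ∀ {F : Seq → Seq} → Congruent F → ∀ n → Congruent (iter F n)
  iter-cong F-cong zero    u≐v = u≐v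
  iter-cong F-cong (suc n) u≐v = F-cong (iter-cong F-cong n u≐v)

  iter-linear : ∀ {F : Seq → Seq} → Congruent F → Linear F → ∀ n → Linear (iter F n)
  iter-linear F-cong F-lin zero    M s vs k = refl
  iter-linear {F} F-cong F-lin (suc n) M s vs k =
    trans (F-cong (iter-linear F-cong F-lin n M s vs) k) (F-lin M s (iter F n ∘ vs) k)

  iter-pointwise : ∀ {F G : Seq → Seq} → Congruent F → (∀ u → F u ≐ G u) → ∀ n u → iter F n u ≐ iter G n u
  iter-pointwise F-cong F≐G zero    u k = refl
  iter-pointwise {G = G} F-cong F≐G (suc n) u k =
    trans (F-cong (iter-pointwise F-cong F≐G n u) k) (F≐G (iter G n u) k)

  iter-intertwine : ∀ {F G S : Seq → Seq} → Congruent F → (∀ u → F (S u) ≐ S (G u)) →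
                    ∀ n u → iter F n (S u) ≐ S (iter G n u)
  iter-intertwine F-cong FS≐SG zero    u k = refl
  iter-intertwine {G = G} F-cong FS≐SG (suc n) u k =
    trans (F-cong (iter-intertwine F-cong FS≐SG n u) k) (FS≐SG (iter G n u) k)

  -- Multiplication by the indeterminate: (shift₁ v)_{k+1} = v_k, (shift₁ v)_0 = 0.
  shift₁ : Seq → Seq
  shift₁ v zero    = 0#
  shift₁ v (suc k) = v k

  shift : ℕ → Seq → Seq
  shift = iter shift₁

  shift₁-cong : Congruent shift₁
  shift₁-cong u≐v zero    = refl
  shift₁-cong u≐v (suc k) = u≐v k

  shift₁-linear : Linear shift₁
  shift₁-linear M s vs zero    = sym (Σ-zero M (λ j _ → zeroʳ (s j)))
  shift₁-linear M s vs (suc k) = refl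

  shift-cong : ∀ j → Congruent (shift j)
  shift-cong = iter-cong shift₁-cong

  shift-linear : ∀ j → Linear (shift j)
  shift-linear = iter-linear shift₁-cong shift₁-linear

  δ : Seq
  δ zero    = 1#
  δ (suc k) = 0#

  shift-δ-diag : ∀ k → shift k δ k ≈ 1#
  shift-δ-diag zero    = refl
  shift-δ-diag (suc k) = shift-δ-diag k

  shift-δ-off : ∀ j k → ¬ j ≡.≡ k → shift j δ k ≈ 0#
  shift-δ-off zero    zero    j≢k = ⊥-elim (j≢k ≡.refl)
  shift-δ-off zero    (suc k) j≢k = refl
  shift-δ-off (suc j) zero    j≢k = refl
  shift-δ-off (suc j) (suc k) j≢k = shift-δ-off j k (j≢k ∘ ≡.cong suc)

  SupportedIn : ℕ → Seq → Set ℓ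
  SupportedIn d v = ∀ k → d < k → v k ≈ 0#

  shift-supported : ∀ j d v → SupportedIn d v → SupportedIn (j ℕ.+ d) (shift j v)
  shift-supported zero    d v supp k       d<k       = supp k d<k
  shift-supported (suc j) d v supp (suc k) (s≤s j+d<k) = shift-supported j d v supp k j+d<k

  basis-outside : ∀ l f k → l < k → combo l f (λ j → shift j δ) k ≈ 0#
  basis-outside l f k l<k = Σ-zero l (λ j j≤l →
    trans (*-congˡ (shift-δ-off j k (λ { ≡.refl → ℕₚ.<-irrefl ≡.refl (ℕₚ.≤-<-trans j≤l l<k) })))
          (zeroʳ _))

  basis-inside : ∀ l f k → k ≤ l → combo l f (λ j → shift j δ) k ≈ f k
  basis-inside zero    f zero z≤n = *-identityʳ _
  basis-inside (suc l) f k k≤l with ℕₚ.m≤n⇒m<n∨m≡n k≤l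
  ... | inj₂ ≡.refl = begin
    combo l f (λ j → shift j δ) (suc l) + f (suc l) * shift (suc l) δ (suc l)
      ≈⟨ +-cong (basis-outside l f (suc l) (ℕₚ.n<1+n l)) (*-congˡ (shift-δ-diag (suc l))) ⟩
    0# + f (suc l) * 1#  ≈⟨ trans (+-identityˡ _) (*-identityʳ _) ⟩
    f (suc l)            ∎
  ... | inj₁ (s≤s k≤l′) = begin
    combo l f (λ j → shift j δ) k + f (suc l) * shift (suc l) δ k
      ≈⟨ +-cong (basis-inside l f k k≤l′)
                (*-congˡ (shift-δ-off (suc l) k (λ { ≡.refl → ℕₚ.<-irrefl ≡.refl (s≤s k≤l′) }))) ⟩
    f k + f (suc l) * 0#  ≈⟨ trans (+-congˡ (zeroʳ _)) (+-identityʳ _) ⟩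
    f k                   ∎

  basis-expansion : ∀ l v → SupportedIn l v → v ≐ combo l v (λ j → shift j δ)
  basis-expansion l v supp k with k ℕₚ.≤? l
  ... | yes k≤l = sym (basis-inside l v k k≤l)
  ... | no  k≰l = trans (supp k (ℕₚ.≰⇒> k≰l)) (sym (basis-outside l v k (ℕₚ.≰⇒> k≰l)))

  -- The coefficient C(n,i) · a^(n-i) of Tⁱ in the expansion of (T + a)ⁿ.
  binom : ℕ → Carrier → ℕ → Carrier
  binom n a i = ι (n C i) * a ^ (n ∸ i)

  ι-pascal : ∀ n i → ι (suc n C suc i) ≈ ι (n C i) + ι (n C suc i)
  ι-pascal n i = trans (reflexive (≡.cong ι (≡.sym (nCk+nC[k+1]≡[n+1]C[k+1] n i))))
                       (×-homo-+ 1# (n C i) (n C suc i))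

  -- C(n,i+1) a^(n-i) = a · C(n,i+1) a^(n-i-1); for i = n both sides vanish.
  binom-raise : ∀ n a i → i ≤ n → ι (n C suc i) * a ^ (n ∸ i) ≈ a * binom n a (suc i)
  binom-raise n a i i≤n with ℕₚ.m≤n⇒m<n∨m≡n i≤n
  ... | inj₁ i<n rewrite ℕₚ.+-∸-assoc 1 i<n =
    solve 3 (λ C a e → C :* (a :* e) := a :* (C :* e)) refl _ a _
  ... | inj₂ ≡.refl rewrite k>n⇒nCk≡0 (ℕₚ.n<1+n n) =
    trans (zeroˡ _) (sym (trans (*-congˡ (zeroˡ _)) (zeroʳ a)))

  binom-pascal : ∀ n a i → i ≤ n → binom (suc n) a (suc i) ≈ binom n a i + a * binom n a (suc i)
  binom-pascal n a i i≤n =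
    trans (trans (*-congʳ (ι-pascal n i)) (distribʳ _ _ _)) (+-congˡ (binom-raise n a i i≤n))

  binom-first : ∀ n a → binom (suc n) a 0 ≈ a * binom n a 0
  binom-first n a = solve 3 (λ C a e → C :* (a :* e) := a :* (C :* e)) refl _ a _

  binom-beyond : ∀ n a → binom n a (suc n) ≈ 0#
  binom-beyond n a rewrite k>n⇒nCk≡0 (ℕₚ.n<1+n n) = zeroˡ _

  -- Multiplying Σ_i binom n a i · Tⁱ by (T + a): if t_{i+1} plays the role of T t_i,
  -- the coefficients of the product are those of (T + a)ⁿ⁺¹.
  binomial-step : ∀ n a (t : ℕ → Carrier) →
                  Σ≤ n (λ i → binom n a i * (t (suc i) + a * t i))
                  ≈ Σ≤ (suc n) (λ i → binom (suc n) a i * t i)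
  binomial-step n a t = begin
    Σ≤ n (λ i → b i * (t (suc i) + a * t i))
      ≈⟨ Σ-cong n (λ i → solve 4 (λ b u a v → b :* (u :+ a :* v) := b :* u :+ (a :* b) :* v)
                                   refl (b i) (t (suc i)) a (t i)) ⟩
    Σ≤ n (λ i → b i * t (suc i) + (a * b i) * t i)
      ≈⟨ Σ-+ n _ _ ⟩
    X + Σ≤ n (λ i → (a * b i) * t i)
      ≈⟨ +-congˡ (sym (trans (+-congˡ top-vanishes) (+-identityʳ _))) ⟩
    X + Σ≤ (suc n) (λ i → (a * b i) * t i)
      ≈⟨ +-congˡ (Σ-head n _) ⟩
    X + ((a * b 0) * t 0 + Y)
      ≈⟨ solve 3 (λ X h Y → X :+ (h :+ Y) := h :+ (X :+ Y)) refl X _ Y ⟩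
    (a * b 0) * t 0 + (X + Y)
      ≈⟨ +-congˡ (Σ-+ n _ _) ⟨
    (a * b 0) * t 0 + Σ≤ n (λ i → b i * t (suc i) + (a * b (suc i)) * t (suc i))
      ≈⟨ +-cong (*-congʳ (binom-first n a)) (Σ-congᵇ n (λ i i≤n →
           trans (*-congʳ (binom-pascal n a i i≤n)) (distribʳ _ _ _))) ⟨
    b′ 0 * t 0 + Σ≤ n (λ i → b′ (suc i) * t (suc i))
      ≈⟨ Σ-head n _ ⟨
    Σ≤ (suc n) (λ i → b′ i * t i)
      ∎
    where
    b b′ : ℕ → Carrier
    b  = binom n a
    b′ = binom (suc n) a
    X Y : Carrier
    X = Σ≤ n (λ i → b i * t (suc i))
    Y = Σ≤ n (λ i → (a * b (suc i)) * t (suc i))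
    top-vanishes : (a * b (suc n)) * t (suc n) ≈ 0#
    top-vanishes = trans (*-congʳ (trans (*-congˡ (binom-beyond n a)) (zeroʳ a))) (zeroˡ _)

  binom-zero : ∀ a v → binom 0 a 0 * v ≈ v
  binom-zero a v = trans (*-congʳ (trans (*-identityʳ _) (+-identityʳ 1#))) (*-identityˡ v)

  module Evaluation (x : Carrier) where

    ev : ℕ → Seq → Carrier
    ev N v = Σ≤ N (λ k → v k * x ^ k)

    ev-cong : ∀ N {u v} → u ≐ v → ev N u ≈ ev N v
    ev-cong N u≐v = Σ-cong N (λ k → *-congʳ (u≐v k))

    ev-linear : ∀ N M s vs → ev N (combo M s vs) ≈ Σ≤ M (λ j → s j * ev N (vs j))
    ev-linear N M s vs = begin
      Σ≤ N (λ k → Σ≤ M (λ j → s j * vs j k) * x ^ k)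
        ≈⟨ Σ-cong N (λ k → trans (sym (Σ-*ʳ M _ _)) (Σ-cong M (λ j → *-assoc _ _ _))) ⟩
      Σ≤ N (λ k → Σ≤ M (λ j → s j * (vs j k * x ^ k)))
        ≈⟨ Σ-swap N M _ ⟩
      Σ≤ M (λ j → Σ≤ N (λ k → s j * (vs j k * x ^ k)))
        ≈⟨ Σ-cong M (λ j → Σ-*ˡ N (s j) _) ⟩
      Σ≤ M (λ j → s j * ev N (vs j))
        ∎

    ev-truncate : ∀ d N v → SupportedIn d v → d ≤ N → ev N v ≈ ev d v
    ev-truncate d N v supp d≤N with ℕₚ.m≤n⇒m<n∨m≡n d≤N
    ... | inj₂ ≡.refl = refl
    ev-truncate d (suc N) v supp _ | inj₁ (s≤s d≤N) =
      trans (+-cong (ev-truncate d N v supp d≤N) (trans (*-congʳ (supp (suc N) (s≤s d≤N))) (zeroˡ _)))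
            (+-identityʳ _)

    ev-shift : ∀ j d v → ev (j ℕ.+ d) (shift j v) ≈ x ^ j * ev d v
    ev-shift zero    d v = sym (*-identityˡ _)
    ev-shift (suc j) d v = begin
      ev (suc j ℕ.+ d) (shift (suc j) v)
        ≈⟨ Σ-head (j ℕ.+ d) _ ⟩
      0# * 1# + Σ≤ (j ℕ.+ d) (λ k → shift j v k * (x * x ^ k))
        ≈⟨ +-cong (zeroˡ 1#) (Σ-cong (j ℕ.+ d) (λ k →
             solve 3 (λ s x e → s :* (x :* e) := x :* (s :* e)) refl (shift j v k) x (x ^ k))) ⟩
      0# + Σ≤ (j ℕ.+ d) (λ k → x * (shift j v k * x ^ k))
        ≈⟨ trans (+-identityˡ _) (Σ-*ˡ (j ℕ.+ d) x _) ⟩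
      x * ev (j ℕ.+ d) (shift j v)
        ≈⟨ *-congˡ (ev-shift j d v) ⟩
      x * (x ^ j * ev d v)
        ≈⟨ *-assoc _ _ _ ⟨
      x ^ suc j * ev d v
        ∎

  module Whitney (m : Carrier) where

    T : Seq → Seq
    T v zero    = (m * ι 0 + 1#) * v 0
    T v (suc k) = v k + (m * ι (suc k) + 1#) * v (suc k)

    U : Carrier → Seq → Seq
    U a v k = T v k + a * v k

    T-cong : Congruent T
    T-cong u≐v zero    = *-congˡ (u≐v 0)
    T-cong u≐v (suc k) = +-cong (u≐v k) (*-congˡ (u≐v (suc k)))

    T-linear : Linear T
    T-linear M s vs zero    = combo-scale M _ s (λ j → vs j 0)
    T-linear M s vs (suc k) = combo-step M _ s (λ j → vs j k) (λ j → vs j (suc k))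

    U-cong : ∀ a → Congruent (U a)
    U-cong a u≐v k = +-cong (T-cong u≐v k) (*-congˡ (u≐v k))

    U-linear : ∀ a → Linear (U a)
    U-linear a M s vs k =
      trans (+-congʳ (T-linear M s vs k)) (combo-step M a s (λ j → T (vs j) k) (λ j → vs j k))

    U-param : ∀ {a b} → a ≈ b → ∀ v → U a v ≐ U b v
    U-param a≈b v k = +-congˡ (*-congʳ a≈b)

    T≐U₀ : ∀ v → T v ≐ U 0# v
    T≐U₀ v k = sym (trans (+-congˡ (zeroˡ _)) (+-identityʳ _))

    -- (T v)_k with the shifted term split off; the position-0 case is uniform with k > 0.
    T-split : ∀ v k → T v k ≈ shift₁ v k + (m * ι k + 1#) * v k
    T-split v zero    = sym (+-identityˡ _)
    T-split v (suc k) = refl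

    -- U_a ∘ shift₁ = shift₁ ∘ U_{a+m}: at position k+1 the factor m(k+1)+1 is (mk+1) + m.
    shift₁-intertwine : ∀ a u → U a (shift₁ u) ≐ shift₁ (U (a + m) u)
    shift₁-intertwine a u zero    = trans (+-cong (zeroʳ _) (zeroʳ a)) (+-identityʳ 0#)
    shift₁-intertwine a u (suc k) = begin
      (shift₁ u k + (m * (1# + ι k) + 1#) * u k) + a * u k
        ≈⟨ solve 5 (λ s m i u a → (s :+ (m :* (con 1 :+ i) :+ con 1) :* u) :+ a :* u
                                  := (s :+ (m :* i :+ con 1) :* u) :+ (a :+ m) :* u)
                   refl (shift₁ u k) m (ι k) (u k) a ⟩
      (shift₁ u k + (m * ι k + 1#) * u k) + (a + m) * u k
        ≈⟨ +-congʳ (T-split u k) ⟨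
      T u k + (a + m) * u k
        ∎

    shift-intertwine : ∀ j n a v → iter (U a) n (shift j v) ≐ shift j (iter (U (a + m * ι j)) n v)
    shift-intertwine zero n a v =
      iter-pointwise (U-cong a) (U-param (sym (trans (+-congˡ (zeroʳ m)) (+-identityʳ a)))) n v
    shift-intertwine (suc j) n a v k = begin
      iter (U a) n (shift₁ (shift j v)) k
        ≈⟨ iter-intertwine (U-cong a) (shift₁-intertwine a) n (shift j v) k ⟩
      shift₁ (iter (U (a + m)) n (shift j v)) k
        ≈⟨ shift₁-cong (shift-intertwine j n (a + m) v) k ⟩
      shift (suc j) (iter (U ((a + m) + m * ι j)) n v) k
        ≈⟨ shift-cong (suc j) (iter-pointwise (U-cong _) (U-param param) n v) k ⟩
      shift (suc j) (iter (U (a + m * ι (suc j))) n v) k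
        ∎
      where
      param : (a + m) + m * ι j ≈ a + m * (1# + ι j)
      param = solve 3 (λ a m i → (a :+ m) :+ m :* i := a :+ m :* (con 1 :+ i)) refl a m (ι j)

    binomial : ∀ n a v → iter (U a) n v ≐ combo n (binom n a) (λ i → iter T i v)
    binomial zero    a v k = sym (binom-zero a (v k))
    binomial (suc n) a v k = begin
      U a (iter (U a) n v) k
        ≈⟨ U-cong a (binomial n a v) k ⟩
      U a (combo n (binom n a) (λ i → iter T i v)) k
        ≈⟨ U-linear a n (binom n a) (λ i → iter T i v) k ⟩
      Σ≤ n (λ i → binom n a i * (iter T (suc i) v k + a * iter T i v k))
        ≈⟨ binomial-step n a (λ i → iter T i v k) ⟩
      combo (suc n) (binom (suc n) a) (λ i → iter T i v) k
        ∎

    W-step : ∀ i → W m (suc i) ≐ T (W m i)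
    W-step i zero    = refl
    W-step i (suc k) = refl

    W-row : ∀ i → W m i ≐ iter T i δ
    W-row zero    zero    = refl
    W-row zero    (suc k) = refl
    W-row (suc i) k       = trans (W-step i k) (T-cong (W-row i) k)

    W-add : ∀ n l → W m (n ℕ.+ l) ≐ iter T n (W m l)
    W-add zero    l k = refl
    W-add (suc n) l k = trans (W-step (n ℕ.+ l) k) (T-cong (W-add n l) k)

    W-supported : ∀ i → SupportedIn i (W m i)
    W-supported zero    (suc k) _         = refl
    W-supported (suc i) (suc k) (s≤s i<k) =
      trans (+-cong (W-supported i k i<k) (*-congˡ (W-supported i (suc k) (ℕₚ.m≤n⇒m≤1+n i<k))))
            (trans (+-congˡ (zeroʳ _)) (+-identityʳ 0#))

    T-power-on-basis : ∀ n j →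
      iter T n (shift j δ) ≐ combo n (binom n (m * ι j)) (λ i → shift j (W m i))
    T-power-on-basis n j k = begin
      iter T n (shift j δ) k
        ≈⟨ iter-pointwise T-cong T≐U₀ n (shift j δ) k ⟩
      iter (U 0#) n (shift j δ) k
        ≈⟨ shift-intertwine j n 0# δ k ⟩
      shift j (iter (U (0# + m * ι j)) n δ) k
        ≈⟨ shift-cong j (iter-pointwise (U-cong _) (U-param (+-identityˡ _)) n δ) k ⟩
      shift j (iter (U (m * ι j)) n δ) k
        ≈⟨ shift-cong j (binomial n (m * ι j) δ) k ⟩
      shift j (combo n (binom n (m * ι j)) (λ i → iter T i δ)) k
        ≈⟨ shift-cong j (combo-cong n _ (λ i → sym ∘ W-row i)) k ⟩
      shift j (combo n (binom n (m * ι j)) (W m)) k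
        ≈⟨ shift-linear j n _ (W m) k ⟩
      combo n (binom n (m * ι j)) (λ i → shift j (W m i)) k
        ∎

    whitney-convolution : ∀ n l →
      W m (n ℕ.+ l) ≐ combo l (W m l) (λ j → combo n (binom n (m * ι j)) (λ i → shift j (W m i)))
    whitney-convolution n l k = begin
      W m (n ℕ.+ l) k
        ≈⟨ W-add n l k ⟩
      iter T n (W m l) k
        ≈⟨ iter-cong T-cong n (basis-expansion l (W m l) (W-supported l)) k ⟩
      iter T n (combo l (W m l) (λ j → shift j δ)) k
        ≈⟨ iter-linear T-cong T-linear n l (W m l) (λ j → shift j δ) k ⟩
      combo l (W m l) (λ j → iter T n (shift j δ)) k
        ≈⟨ combo-cong l (W m l) (T-power-on-basis n) k ⟩
      combo l (W m l) (λ j → combo n (binom n (m * ι j)) (λ i → shift j (W m i))) k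
        ∎

    module _ (x : Carrier) where
      open Evaluation x

      ev-shifted-row : ∀ n l j i → j ≤ l → i ≤ n → ev (n ℕ.+ l) (shift j (W m i)) ≈ x ^ j * D m i x
      ev-shifted-row n l j i j≤l i≤n =
        trans (ev-truncate (j ℕ.+ i) (n ℕ.+ l) _ (shift-supported j i (W m i) (W-supported i)) j+i≤n+l)
              (ev-shift j i (W m i))
        where
        j+i≤n+l : j ℕ.+ i ≤ n ℕ.+ l
        j+i≤n+l = ≡.subst (j ℕ.+ i ≤_) (ℕₚ.+-comm l n) (ℕₚ.+-mono-≤ j≤l i≤n)

      dowling-polynomial-expansion : ∀ n l →
        D m (n ℕ.+ l) x ≈ Σ≤ l (λ j → Σ≤ n (λ k →
          (((W m l j * ι (n C k)) * (m * ι j) ^ (n ∸ k)) * D m k x) * x ^ j))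
      dowling-polynomial-expansion n l = begin
        ev (n ℕ.+ l) (W m (n ℕ.+ l))
          ≈⟨ ev-cong (n ℕ.+ l) (whitney-convolution n l) ⟩
        ev (n ℕ.+ l) (combo l (W m l) (λ j → combo n (b j) (λ i → shift j (W m i))))
          ≈⟨ ev-linear (n ℕ.+ l) l (W m l) _ ⟩
        Σ≤ l (λ j → W m l j * ev (n ℕ.+ l) (combo n (b j) (λ i → shift j (W m i))))
          ≈⟨ Σ-cong l (λ j → *-congˡ (ev-linear (n ℕ.+ l) n (b j) _)) ⟩
        Σ≤ l (λ j → W m l j * Σ≤ n (λ i → b j i * ev (n ℕ.+ l) (shift j (W m i))))
          ≈⟨ Σ-congᵇ l (λ j j≤l → *-congˡ (Σ-congᵇ n (λ i i≤n →
               *-congˡ (ev-shifted-row n l j i j≤l i≤n)))) ⟩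
        Σ≤ l (λ j → W m l j * Σ≤ n (λ i → b j i * (x ^ j * D m i x)))
          ≈⟨ Σ-cong l (λ j → trans (sym (Σ-*ˡ n _ _)) (Σ-cong n (λ i →
               solve 5 (λ w C p X d → w :* ((C :* p) :* (X :* d)) := (((w :* C) :* p) :* d) :* X)
                       refl (W m l j) (ι (n C i)) ((m * ι j) ^ (n ∸ i)) (x ^ j) (D m i x)))) ⟩
        Σ≤ l (λ j → Σ≤ n (λ k → (((W m l j * ι (n C k)) * (m * ι j) ^ (n ∸ k)) * D m k x) * x ^ j))
          ∎
        where
        b : ℕ → ℕ → Carrier
        b j = binom n (m * ι j)

    dowling-number-expansion : ∀ n l →
      Dnum m (n ℕ.+ l) ≈ Σ≤ l (λ j → Σ≤ n (λ k → ((W m l j * ι (n C k)) * (m * ι j) ^ (n ∸ k)) * Dnum m k))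
    dowling-number-expansion n l =
      trans (dowling-polynomial-expansion 1# n l)
            (Σ-cong l (λ j → Σ-cong n (λ k → trans (*-congˡ (one-power j)) (*-identityʳ _))))
      where
      one-power : ∀ j → 1# ^ j ≈ 1#
      one-power zero    = refl
      one-power (suc j) = trans (*-identityˡ _) (one-power j)

open DowlingExpansion using (module Whitney)
open CommutativeRing using (Carrier; _≈_; _*_; 1#)
open Dowling using (D; Dnum; W; Σ≤; ι; _^_)
open import Data.Product using (_×_; _,_)

corollary6 : {c ℓ : Level} (R : CommutativeRing c ℓ) (m : Carrier R) (n l : ℕ) →
    ((x : Carrier R) → _≈_ R (D R m (n ℕ.+ l) x) (Σ≤ R l (λ j → Σ≤ R n (λ k → _*_ R (_*_ R (_*_ R (_*_ R (W R m l j) (ι R (n C k))) (_^_ R (_*_ R m (ι R j)) (n ∸ k))) (D R m k x)) (_^_ R x j)))))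
    × _≈_ R (Dnum R m (n ℕ.+ l)) (Σ≤ R l (λ j → Σ≤ R n (λ k → _*_ R (_*_ R (_*_ R (W R m l j) (ι R (n C k))) (_^_ R (_*_ R m (ι R j)) (n ∸ k))) (Dnum R m k))))
corollary6 R m n l =
  (λ x → Whitney.dowling-polynomial-expansion R m x n l) , Whitney.dowling-number-expansion R m n l
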